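{- Let $T$ be a CNAT. Suppose that $T$ has an internal dot one of whose two children is a leaf and the other of which is an internal dot. Then $T$ contains at least one long leaf.
   Context: A non-ambiguous tree (NAT) is a filling of a rectangular grid in which each cell is dotted or not, such that: the top-left cell is dotted (the root); every dotted cell other than the root has either a dotted cell above it in the same column or a dotted cell to its left in the same row, but not both; and every row and every column contains at least one dotted cell. Each non-root dot $d$ has a parent: the nearest dot above it in its column, or the nearest dot to its left in its row. A complete non-ambiguous tree (CNAT) is a NAT in which every dot either has both a dot below it in its column and a dot to its right in its row (an internal dot), or neither (a leaf). The children of an internal dot are the dots whose parent it is: one in its column (left child) and one in its row (right child). A leaf is short if its parent lies in a cell adjacent to it, and long otherwise. -}

module Defs where

open import Data.Nat using (ℕ; suc)
open import Data.Fin using (Fin; zero; toℕ; _<_)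
open import Data.Bool using (Bool; true)
open import Data.Product using (Σ; ∃; ∃-syntax; _×_; _,_)
open import Data.Sum using (_⊎_)
open import Relation.Binary.PropositionalEquality using (_≡_; _≢_)
open import Relation.Nullary using (¬_)

-- A filling of an m × n grid (rows indexed by Fin m, top to bottom;
-- columns indexed by Fin n, left to right); a cell is dotted iff the
-- function returns true.
Filling : ℕ → ℕ → Set
Filling m n = Fin m → Fin n → Bool

Cell : ℕ → ℕ → Set
Cell m n = Fin m × Fin n

module _ {m n : ℕ} (T : Filling m n) where

  Dot : Cell m n → Set
  Dot (i , j) = T i j ≡ true

  DotAbove DotBelow DotLeft DotRight : Cell m n → Set
  DotAbove (i , j) = ∃[ i' ] (i' < i × Dot (i' , j))
  DotBelow (i , j) = ∃[ i' ] (i < i' × Dot (i' , j))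
  DotLeft  (i , j) = ∃[ j' ] (j' < j × Dot (i , j'))
  DotRight (i , j) = ∃[ j' ] (j < j' × Dot (i , j'))

  IsParent : Cell m n → Cell m n → Set
  IsParent (pi , pj) (ci , cj) =
    Dot (pi , pj) × Dot (ci , cj) ×
    ( (pj ≡ cj × pi < ci ×
        (∀ (k : Fin m) → pi < k → k < ci → ¬ Dot (k , cj)))
    ⊎ (pi ≡ ci × pj < cj ×
        (∀ (k : Fin n) → pj < k → k < cj → ¬ Dot (ci , k))) )


_Xor_ : Set → Set → Set
A Xor B = (A × ¬ B) ⊎ (¬ A × B)

-- non-ambiguous tree on a (suc m) × (suc n) grid (the root (0,0) forces
-- the grid to be non-empty)
record IsNAT {m n : ℕ} (T : Filling (suc m) (suc n)) : Set where
  field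
    root     : Dot T (zero , zero)
    parentOK : ∀ (c : Cell (suc m) (suc n)) → Dot T c → c ≢ (zero , zero) →
               DotAbove T c Xor DotLeft T c
    rowsOK   : ∀ (i : Fin (suc m)) → ∃[ j ] Dot T (i , j)
    colsOK   : ∀ (j : Fin (suc n)) → ∃[ i ] Dot T (i , j)

module _ {m n : ℕ} (T : Filling m n) where

  Internal : Cell m n → Set
  Internal c = Dot T c × DotBelow T c × DotRight T c

  Leaf : Cell m n → Set
  Leaf c = Dot T c × ¬ DotBelow T c × ¬ DotRight T c

record IsCNAT {m n : ℕ} (T : Filling (suc m) (suc n)) : Set where
  field
    isNAT    : IsNAT T
    complete : ∀ (c : Cell (suc m) (suc n)) → Dot T c →
               (DotBelow T c × DotRight T c) ⊎ (¬ DotBelow T c × ¬ DotRight T c)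

Adjacent : {m n : ℕ} → Cell m n → Cell m n → Set
Adjacent (i , j) (i' , j') =
  (i ≡ i' × (suc (toℕ j) ≡ toℕ j' ⊎ suc (toℕ j') ≡ toℕ j)) ⊎
  (j ≡ j' × (suc (toℕ i) ≡ toℕ i' ⊎ suc (toℕ i') ≡ toℕ i))

module _ {m n : ℕ} (T : Filling m n) where

  ShortLeaf : Cell m n → Set
  ShortLeaf c = Leaf T c × ∃[ p ] (IsParent T p c × Adjacent p c)

  LongLeaf : Cell m n → Set
  LongLeaf c = Leaf T c × ∃[ p ] (IsParent T p c × ¬ Adjacent p c)

-- Suppose every leaf is short. Then below an internal dot (i , j) the next row always
-- contains a dot weakly to the right of column j: either the nearest dot below lies in
-- row i + 1, or the row child's subtree provides one. The row child cannot be a short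
-- leaf in that case: the column child, lying below row i + 1, is not a short leaf, and
-- if it is internal its subtree puts a dot in the next column below the row child.
-- Transposing the grid swaps rows and columns, so the same holds for columns. For the
-- given dot, if its leaf child lies in the next row, the internal sibling's subtree puts
-- a dot to the right of that leaf, which is impossible.

module Submission where

open import Defs
open import Data.Bool using (true)
import Data.Bool.Properties as Bool
open import Data.Empty using (⊥-elim)
open import Data.Fin using (Fin; toℕ; _<_; _≤_) renaming (zero to fzero; suc to fsuc)
import Data.Fin.Properties as Fin
open import Data.Nat using (ℕ; suc; _∸_; _+_; s≤s) renaming (_<_ to _<ℕ_)
import Data.Nat.Properties as ℕ
open import Data.Nat.Induction using (<-wellFounded)
open import Data.Product using (∃-syntax; _×_; _,_; proj₁; proj₂; map; swap)
open import Data.Sum as Sum using (_⊎_; inj₁; inj₂)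
open import Function using (_∘_; id)
open import Induction.WellFounded using (Acc; acc)
open import Relation.Binary using (tri<; tri≈; tri>)
open import Relation.Binary.PropositionalEquality using (_≡_; _≢_; refl; sym; trans; subst)
open import Relation.Nullary using (¬_; yes; no; contradiction)
open import Relation.Nullary.Decidable using (_×-dec_)
open import Relation.Unary using (Pred; Decidable)

least-witness : ∀ {k p} {P : Pred (Fin k) p} → Decidable P →
                ∀ {x} → P x → ∃[ y ] (P y × ∀ z → z < y → ¬ P z)
least-witness P? {fzero} p₀ = fzero , p₀ , λ _ ()
least-witness {P = P} P? {fsuc x} px with P? fzero
... | yes p₀ = fzero , p₀ , λ _ ()
... | no ¬p₀ with least-witness {P = P ∘ fsuc} (P? ∘ fsuc) px
... | y , py , below = fsuc y , py , λ { fzero _ → ¬p₀ ; (fsuc z) (s≤s z<y) → below z z<y }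

transpose : ∀ {m n} → Filling m n → Filling n m
transpose T j i = T i j

module _ {m n : ℕ} (T : Filling m n) where

  NearestDotBelow : Cell m n → Fin m → Set
  NearestDotBelow (i , j) i′ =
    i < i′ × Dot T (i′ , j) × (∀ k → i < k → k < i′ → ¬ Dot T (k , j))

  DotInNextRow : Cell m n → Set
  DotInNextRow (i , j) =
    ∃[ i′ ] ∃[ j′ ] (suc (toℕ i) ≡ toℕ i′ × j ≤ j′ × Dot T (i′ , j′))

  IsComplete : Set
  IsComplete = ∀ c → Dot T c → Internal T c ⊎ Leaf T c

module _ {m n : ℕ} {T : Filling m n} where

  nearestDotBelow : ∀ {c} → DotBelow T c → ∃[ i′ ] NearestDotBelow T c i′
  nearestDotBelow {i , j} (_ , below) with least-witness dec below
    where
    dec : Decidable (λ k → i < k × Dot T (k , j))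
    dec k = (i Fin.<? k) ×-dec (T k j Bool.≟ true)
  ... | i′ , (i<i′ , dot′) , nearest =
    i′ , i<i′ , dot′ , λ k i<k k<i′ dotₖ → nearest k k<i′ (i<k , dotₖ)

  nearestDotBelow-unique : ∀ {c i₁ i₂} →
    NearestDotBelow T c i₁ → NearestDotBelow T c i₂ → i₁ ≡ i₂
  nearestDotBelow-unique {_ , _} {i₁} {i₂} (i<i₁ , dot₁ , gap₁) (i<i₂ , dot₂ , gap₂)
    with Fin.<-cmp i₁ i₂
  ... | tri< i₁<i₂ _ _ = contradiction dot₁ (gap₂ i₁ i<i₁ i₁<i₂)
  ... | tri≈ _ i₁≡i₂ _ = i₁≡i₂
  ... | tri> _ _ i₂<i₁ = contradiction dot₂ (gap₁ i₂ i<i₂ i₂<i₁)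

  parent-below : ∀ {i j i′} → Dot T (i , j) → NearestDotBelow T (i , j) i′ →
                 IsParent T (i , j) (i′ , j)
  parent-below dot (i<i′ , dot′ , gap) = dot , dot′ , inj₁ (refl , i<i′ , gap)

Adjacent-transpose : ∀ {m n} {c c′ : Cell m n} → Adjacent c c′ → Adjacent (swap c) (swap c′)
Adjacent-transpose {c = _ , _} {c′ = _ , _} = Sum.swap

¬Adjacent-below : ∀ {m n} {i i′ : Fin m} {j : Fin n} → i < i′ → suc (toℕ i) ≢ toℕ i′ →
                  ¬ Adjacent (i , j) (i′ , j)
¬Adjacent-below i<i′ _     (inj₁ (i≡i′ , _))       = Fin.<-irrefl i≡i′ i<i′
¬Adjacent-below _    i+1≢i′  (inj₂ (_ , inj₁ i+1≡i′)) = i+1≢i′ i+1≡i′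
¬Adjacent-below i<i′ _     (inj₂ (_ , inj₂ i′+1≡i)) =
  ℕ.<-asym i<i′ (ℕ.≤-reflexive i′+1≡i)

module _ {m n : ℕ} {T : Filling m n} where

  Internal-transpose : ∀ {c} → Internal T c → Internal (transpose T) (swap c)
  Internal-transpose {_ , _} (dot , below , right) = dot , right , below

  Leaf-transpose : ∀ {c} → Leaf T c → Leaf (transpose T) (swap c)
  Leaf-transpose {_ , _} (dot , ¬below , ¬right) = dot , ¬right , ¬below

  IsParent-transpose : ∀ {p c} → IsParent T p c → IsParent (transpose T) (swap p) (swap c)
  IsParent-transpose {_ , _} {_ , _} (dotₚ , dotᶜ , link) = dotₚ , dotᶜ , Sum.swap link

  LongLeaf-transpose : ∀ {c} → LongLeaf T c → LongLeaf (transpose T) (swap c)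
  LongLeaf-transpose {_ , _} (leaf , p , parent , ¬adjacent) =
    Leaf-transpose leaf , swap p , IsParent-transpose parent , ¬adjacent ∘ Adjacent-transpose

  IsComplete-transpose : IsComplete T → IsComplete (transpose T)
  IsComplete-transpose complete (j , i) dot =
    Sum.map Internal-transpose Leaf-transpose (complete (i , j) dot)

IsCNAT⇒IsComplete : ∀ {m n} {T : Filling (suc m) (suc n)} → IsCNAT T → IsComplete T
IsCNAT⇒IsComplete cnat c dot = Sum.map (dot ,_) (dot ,_) (IsCNAT.complete cnat c dot)

cornerDistance : ∀ {m n} → Cell m n → ℕ
cornerDistance {m} {n} (i , j) = (m ∸ toℕ i) + (n ∸ toℕ j)

cornerDistance-swap : ∀ {m n} (c : Cell m n) → cornerDistance (swap c) ≡ cornerDistance c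
cornerDistance-swap {m} {n} (i , j) = ℕ.+-comm (n ∸ toℕ j) (m ∸ toℕ i)

cornerDistance-right : ∀ {m n} {i : Fin m} {j j′ : Fin n} → j < j′ →
                       cornerDistance (i , j′) <ℕ cornerDistance (i , j)
cornerDistance-right {m} {i = i} {j′ = j′} j<j′ =
  ℕ.+-monoʳ-< (m ∸ toℕ i) (ℕ.∸-monoʳ-< j<j′ (ℕ.<⇒≤ (Fin.toℕ<n j′)))

module _ {m n : ℕ} {T : Filling m n} where

  DotInNextRow-leftwards : ∀ {i : Fin m} {j j′ : Fin n} → j ≤ j′ →
                           DotInNextRow T (i , j′) → DotInNextRow T (i , j)
  DotInNextRow-leftwards j≤j′ (i″ , j″ , next , j′≤j″ , dot) =
    i″ , j″ , next , ℕ.≤-trans j≤j′ j′≤j″ , dot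

  nextRow-blocked : ∀ {i i₁ : Fin m} {j j₂ : Fin n} → Leaf T (i₁ , j) →
                    suc (toℕ i) ≡ toℕ i₁ → j < j₂ → ¬ DotInNextRow T (i , j₂)
  nextRow-blocked {i₁ = i₁} (_ , _ , ¬right) i+1≡i₁ j<j₂ (i′ , j′ , i+1≡i′ , j₂≤j′ , dot′) =
    ¬right (j′ , ℕ.<-≤-trans j<j₂ j₂≤j′ , subst (λ r → Dot T (r , j′)) i′≡i₁ dot′)
    where
    i′≡i₁ : i′ ≡ i₁
    i′≡i₁ = Fin.toℕ-injective (trans (sym i+1≡i′) i+1≡i₁)

-- Induction on the distance to the bottom-right corner; the subtree of the column child is
-- handled by the same statement for the transposed grid.
reachesNextRow : ∀ {m n} (T : Filling m n) → IsComplete T → ∀ {c} →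
                 Acc _<ℕ_ (cornerDistance c) → Internal T c →
                 ∃[ ℓ ] LongLeaf T ℓ ⊎ DotInNextRow T c
reachesNextRow T complete {i , j} (acc smaller) (dot , below , right)
  with nearestDotBelow {T = T} {c = i , j} below | nearestDotBelow {T = transpose T} {c = j , i} right
... | iᵇ , nearestᵇ@(i<iᵇ , dotᵇ , _) | jʳ , nearestʳ@(j<jʳ , dotʳ , _)
  with suc (toℕ i) ℕ.≟ toℕ iᵇ
... | yes adjacentᵇ = inj₂ (iᵇ , j , adjacentᵇ , ℕ.≤-refl , dotᵇ)
... | no ¬adjacentᵇ with complete (i , jʳ) dotʳ
...   | inj₁ internalʳ =
        Sum.map₂ (DotInNextRow-leftwards (ℕ.<⇒≤ j<jʳ))
          (reachesNextRow T complete (smaller (cornerDistance-right {i = i} j<jʳ)) internalʳ)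
...   | inj₂ leafʳ with suc (toℕ j) ℕ.≟ toℕ jʳ
...     | no ¬adjacentʳ =
          inj₁ ((i , jʳ) , leafʳ , (i , j) , IsParent-transpose (parent-below dot nearestʳ) ,
                ¬Adjacent-below j<jʳ ¬adjacentʳ ∘ Adjacent-transpose)
...     | yes adjacentʳ with complete (iᵇ , j) dotᵇ
...       | inj₂ leafᵇ =
            inj₁ ((iᵇ , j) , leafᵇ , (i , j) , parent-below dot nearestᵇ ,
                  ¬Adjacent-below i<iᵇ ¬adjacentᵇ)
...       | inj₁ internalᵇ =
            inj₁ (Sum.[ map swap LongLeaf-transpose
                      , ⊥-elim ∘ nextRow-blocked (Leaf-transpose leafʳ) adjacentʳ i<iᵇ ]
                      (reachesNextRow (transpose T) (IsComplete-transpose complete)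
                         (smaller closer) (Internal-transpose internalᵇ)))
  where
  closer : cornerDistance (j , iᵇ) <ℕ cornerDistance (i , j)
  closer = subst (cornerDistance (j , iᵇ) <ℕ_) (cornerDistance-swap (i , j))
                (cornerDistance-right {i = j} i<iᵇ)

longLeaf-from-leaf-below : ∀ {m n} (T : Filling m n) {a b i₁ c₂} → IsComplete T →
  Dot T (a , b) → NearestDotBelow T (a , b) i₁ → Leaf T (i₁ , b) →
  IsParent T (a , b) c₂ → Internal T c₂ → ∃[ ℓ ] LongLeaf T ℓ
longLeaf-from-leaf-below T {a} {b} {i₁} {_ , _} complete dot nearest₁@(a<i₁ , _) leaf₁
  parent₂ internal₂ with suc (toℕ a) ℕ.≟ toℕ i₁
... | no ¬adjacent =
  (i₁ , b) , leaf₁ , (a , b) , parent-below dot nearest₁ , ¬Adjacent-below a<i₁ ¬adjacent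
... | yes adjacent with parent₂
...   | _ , dot₂ , inj₁ (refl , a<i₂ , gap₂)
        with nearestDotBelow-unique {T = T} nearest₁ (a<i₂ , dot₂ , gap₂)
...     | refl = contradiction (proj₁ (proj₂ internal₂)) (proj₁ (proj₂ leaf₁))
longLeaf-from-leaf-below T complete _ _ leaf₁ _ internal₂ | yes adjacent
      | _ , _ , inj₂ (refl , b<j₂ , _) =
  Sum.[ id , ⊥-elim ∘ nextRow-blocked leaf₁ adjacent b<j₂ ]
    (reachesNextRow T complete (<-wellFounded _) internal₂)

lemma1 : ∀ {m n : ℕ} (T : Filling (suc m) (suc n)) → IsCNAT T →
           (∃[ d ] ∃[ c₁ ] ∃[ c₂ ]
              (Internal T d × IsParent T d c₁ × IsParent T d c₂ ×
               Leaf T c₁ × Internal T c₂)) →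
           ∃[ ℓ ] LongLeaf T ℓ
lemma1 T cnat ((a , b) , (i₁ , j₁) , c₂ , _ , parent₁ , parent₂ , leaf₁ , internal₂)
  with parent₁
... | dot , dot₁ , inj₁ (refl , a<i₁ , gap₁) =
  longLeaf-from-leaf-below T (IsCNAT⇒IsComplete cnat) dot (a<i₁ , dot₁ , gap₁)
    leaf₁ parent₂ internal₂
... | dot , dot₁ , inj₂ (refl , b<j₁ , gap₁) =
  map swap LongLeaf-transpose
    (longLeaf-from-leaf-below (transpose T) (IsComplete-transpose (IsCNAT⇒IsComplete cnat))
       dot (b<j₁ , dot₁ , gap₁) (Leaf-transpose leaf₁)
       (IsParent-transpose {T = T} parent₂) (Internal-transpose {T = T} internal₂))
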